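{- Let $p$ and $q$ be distinct primes, and let $n=p^\alpha q^\beta n'$ and $m=p^\gamma q^\delta m'$ be positive integers with $\alpha,\beta,\gamma,\delta$ positive integers and $\gcd(n',pq)=\gcd(m',pq)=1$. Let $a=p^s$ and $b=q^t$ with integers $s,t\ge 1$, such that $b<2a$ and $a,b$ both divide $\gcd(m,n)$. Define the rational number $$\Delta_{m,n}(a,b):=p^{\alpha+\gamma-2s-1}q^{\beta-t}m'n'.$$ (i) If $n(\frac1a-\frac1b)\ge 3$ and $\{a,b\}\ne\{2,3\}$, then $$a\binom{\frac{m+n}{a}}{\frac{m}{a},\frac{n}{a}}\Big/\binom{\frac{m+n}{b}}{\frac{m}{b},\frac{n}{b}}> 2\,\Delta_{m,n}(a,b)\, q^\delta;$$ consequently, if moreover $\Delta_{m,n}(a,b)\ge 1$, then $$a\binom{\frac{m+n}{a}}{\frac{m}{a},\frac{n}{a}}- (q^\delta-q^t) \binom{\frac{m+n}{b}}{\frac{m}{b},\frac{n}{b}}> 2b\binom{\frac{m+n}{b}}{\frac{m}{b},\frac{n}{b}}. \qquad (*)$$ Moreover, if $n(\frac1a-\frac1b)\ge 3$ and $\{a,b\}=\{2,3\}$, then $(*)$ holds. (ii) If $n(\frac1a-\frac1b)=2$ and $\{a,b\}\ne\{2,3\}$, then $$a\binom{\frac{m+n}{a}}{\frac{m}{a},\frac{n}{a}}\Big/\binom{\frac{m+n}{b}}{\frac{m}{b},\frac{n}{b}}> \Delta_{m,n}(a,b)\, q^\delta;$$ consequently, if moreover $\Delta_{m,n}(a,b)\ge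 1$, then $$a\binom{\frac{m+n}{a}}{\frac{m}{a},\frac{n}{a}}- (q^\delta-q^t) \binom{\frac{m+n}{b}}{\frac{m}{b},\frac{n}{b}}> b\binom{\frac{m+n}{b}}{\frac{m}{b},\frac{n}{b}}.$$
   Context: For nonnegative integers $x,y$, $\binom{x+y}{x,y}$ denotes the multinomial coefficient $\frac{(x+y)!}{x!\,y!}$. -}

module Defs where

open import Data.Nat using (ℕ; zero; suc; _+_; _*_; _/_; NonZero; _!)
open import Data.Nat.Properties using (m*n≢0)
open import Data.Nat.Properties using (_!≢0)
open import Data.Integer using (+_)
import Data.Rational as ℚ
open ℚ using (ℚ)

multinom : ℕ → ℕ → ℕ
multinom x y = (x + y) ! / (x ! * y !)
  where instance
    _ = m*n≢0 (x !) (y !) {{x !≢0}} {{y !≢0}}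

-- the rational number x / d for natural numbers (d ≠ 0 in every use;
-- x ÷ℕ 0 is set to 0 by convention and never occurs in the statement)
_÷ℕ_ : ℕ → ℕ → ℚ
x ÷ℕ zero = ℚ.0ℚ
x ÷ℕ suc d = (+ x) ℚ./ suc d

-- Δ_{m,n}(a,b) = p^(α+γ-2s-1) q^(β-t) m' n', written as
-- p^(α+γ-2s) q^(β-t) m' n' / p  (exponents α+γ-2s, β-t are ≥ 0 under the hypotheses)
Δ : (p q α β γ s t m' n' : ℕ) → ℚ
Δ p q α β γ s t m' n' =
  (p Data.Nat.^ (α Data.Nat.+ γ Data.Nat.∸ (2 * s)) * q Data.Nat.^ (β Data.Nat.∸ t) * m' * n') ÷ℕ p

-- natural-number quotient x / d (only used with d ∣ x and d ≠ 0, so it is exact;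
-- x div 0 = 0 by convention, never occurring in the statement)
_div_ : ℕ → ℕ → ℕ
x div zero = 0
x div suc d = x / suc d

-- Write a = p^s, b = q^t, m = a b x and n = a b y.  Then m/a = b x, n/a = b y, m/b = a x, n/b = a y
-- and Δ q^δ = b x y / p, so with A = C(bx + by, bx) and B = C(ax + ay, ax) every claim reduces to a
-- bound a A / B > b K for K ∈ {x y, x + 1, x}, the integer claims using also q^δ ≤ b x.  Writing
-- b = a + d, Vandermonde's inequality A ≥ B C(dx + dy, dx) turns these bounds into elementary estimates
-- of one binomial coefficient, except when d = x = 1; there A / B is estimated through the ratios
-- C(u, v + 1) / C(u, v) = (u + v + 1) / (v + 1).

module Submission where

open import Defs
open import Data.Nat using (ℕ; _+_; _*_; _^_; _≤_; _<_)
open import Data.Nat.Primality using (Prime)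
open import Data.Nat.Divisibility using (_∣_)
open import Data.Nat.Coprimality using (Coprime)
open import Data.Nat.GCD using (gcd)
open import Data.Product using (_×_)
open import Data.Sum using (_⊎_)
open import Relation.Nullary using (¬_)
open import Relation.Binary.PropositionalEquality using (_≡_; _≢_)
open import Data.Integer using (+_) renaming (_-_ to _-ℤ_; _*_ to _*ℤ_; _<_ to _<ℤ_)
open import Data.Rational using (ℚ; 1ℚ) renaming (_*_ to _*ℚ_; _<_ to _<ℚ_; _≤_ to _≤ℚ_)

open import Data.Empty using (⊥-elim)
open import Data.Integer using (_⊖_) renaming (_+_ to _+ℤ_)
import Data.Integer.Properties as ℤ
import Data.Integer.Tactic.RingSolver as ℤ-Solver
open import Data.Nat using (zero; suc; _∸_; _!; _/_; NonZero; >-nonZero; z≤n; s≤s; z<s; nonTrivial⇒n>1; +-rawMagma)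
open import Data.Nat.DivMod using (m*n/n≡m)
open import Data.Nat.Divisibility using (_∣0; ∣-trans; m∣m*n; *-cancelˡ-∣)
open import Data.Nat.GCD using (gcd[m,n]∣m; gcd[m,n]∣n)
open import Data.Nat.Primality using (¬prime[1]; prime⇒nonZero; prime⇒nonTrivial; prime⇒irreducible; euclidsLemma)
open import Data.Nat.Properties
open import Data.Nat.Tactic.RingSolver using (solve-∀)
open import Algebra.Definitions.RawMagma +-rawMagma using (_,_)
open import Algebra.Properties.CommutativeSemigroup *-commutativeSemigroup using (x∙yz≈y∙xz)
open import Data.Product using (_,_; proj₁; proj₂)
open import Data.Sum using (inj₁; inj₂)
open import Function using (_∘_; _$_)
import Data.Rational as ℚ
import Data.Rational.Properties as ℚ
import Data.Rational.Unnormalised as ℚᵘ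
import Data.Rational.Unnormalised.Properties as ℚᵘ
open import Relation.Binary.PropositionalEquality using (refl; sym; trans; cong; cong₂; subst; subst₂; ≢-sym; module ≡-Reasoning)

pascal : ℕ → ℕ → ℕ
pascal zero    v       = 1
pascal (suc u) zero    = 1
pascal (suc u) (suc v) = pascal u (suc v) + pascal (suc u) v

pascal-*-! : ∀ u v → pascal u v * (u ! * v !) ≡ (u + v) !
pascal-*-! zero    v       = trans (+-identityʳ _) (*-identityˡ _)
pascal-*-! (suc u) zero    = trans (+-identityʳ _) (trans (*-identityʳ _) (cong _! (sym (+-identityʳ (suc u)))))
pascal-*-! (suc u) (suc v) = begin
  (L + R) * ((suc u * u !) * (suc v * v !))
    ≡⟨ distribute L R (u !) (v !) u v ⟩
  suc u * (L * (u ! * (suc v * v !))) + suc v * (R * ((suc u * u !) * v !))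
    ≡⟨ cong₂ (λ l r → suc u * l + suc v * r) (pascal-*-! u (suc v)) (pascal-*-! (suc u) v) ⟩
  suc u * (u + suc v) ! + suc v * (suc u + v) !
    ≡⟨ cong (λ w → suc u * (u + suc v) ! + suc v * w !) (sym (+-suc u v)) ⟩
  suc u * (u + suc v) ! + suc v * (u + suc v) !
    ≡⟨ *-distribʳ-+ ((u + suc v) !) (suc u) (suc v) ⟨
  (suc u + suc v) ! ∎
  where
  open ≡-Reasoning
  L R : ℕ
  L = pascal u (suc v)
  R = pascal (suc u) v
  distribute : ∀ L R fu fv u v → (L + R) * ((suc u * fu) * (suc v * fv))
             ≡ suc u * (L * (fu * (suc v * fv))) + suc v * (R * ((suc u * fu) * fv))
  distribute = solve-∀

multinom≡pascal : ∀ u v → multinom u v ≡ pascal u v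
multinom≡pascal u v = begin
  (u + v) ! / (u ! * v !)                  ≡⟨ cong (_/ (u ! * v !)) (pascal-*-! u v) ⟨
  pascal u v * (u ! * v !) / (u ! * v !)  ≡⟨ m*n/n≡m (pascal u v) (u ! * v !) ⟩
  pascal u v                              ∎
  where
  open ≡-Reasoning
  instance
    u!*v!≢0 : NonZero (u ! * v !)
    u!*v!≢0 = m*n≢0 (u !) (v !) {{u !≢0}} {{v !≢0}}

pascal-comm : ∀ u v → pascal u v ≡ pascal v u
pascal-comm zero    zero    = refl
pascal-comm zero    (suc v) = refl
pascal-comm (suc u) zero    = refl
pascal-comm (suc u) (suc v) = begin
  pascal u (suc v) + pascal (suc u) v  ≡⟨ cong₂ _+_ (pascal-comm u (suc v)) (pascal-comm (suc u) v) ⟩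
  pascal (suc v) u + pascal v (suc u)  ≡⟨ +-comm (pascal (suc v) u) _ ⟩
  pascal v (suc u) + pascal (suc v) u  ∎
  where open ≡-Reasoning

pascal-stepˡ : ∀ u v → suc u * pascal (suc u) v ≡ suc (u + v) * pascal u v
pascal-stepˡ u v = *-cancelʳ-≡ _ _ (u ! * v !) (begin
  suc u * pascal (suc u) v * (u ! * v !)    ≡⟨ shuffle (suc u) (pascal (suc u) v) (u !) (v !) ⟩
  pascal (suc u) v * (suc u ! * v !)        ≡⟨ pascal-*-! (suc u) v ⟩
  suc (u + v) * (u + v) !                   ≡⟨ cong (suc (u + v) *_) (pascal-*-! u v) ⟨
  suc (u + v) * (pascal u v * (u ! * v !))  ≡⟨ *-assoc (suc (u + v)) (pascal u v) _ ⟨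
  suc (u + v) * pascal u v * (u ! * v !)    ∎)
  where
  open ≡-Reasoning
  instance
    u!*v!≢0 : NonZero (u ! * v !)
    u!*v!≢0 = m*n≢0 (u !) (v !) {{u !≢0}} {{v !≢0}}
  shuffle : ∀ k r fu fv → k * r * (fu * fv) ≡ r * ((k * fu) * fv)
  shuffle = solve-∀

pascal-stepʳ : ∀ u v → suc v * pascal u (suc v) ≡ suc (u + v) * pascal u v
pascal-stepʳ u v = begin
  suc v * pascal u (suc v)   ≡⟨ cong (suc v *_) (pascal-comm u (suc v)) ⟩
  suc v * pascal (suc v) u   ≡⟨ pascal-stepˡ v u ⟩
  suc (v + u) * pascal v u   ≡⟨ cong₂ (λ w r → suc w * r) (+-comm v u) (pascal-comm v u) ⟩
  suc (u + v) * pascal u v   ∎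
  where open ≡-Reasoning

0<pascal : ∀ u v → 0 < pascal u v
0<pascal zero    v       = z<s
0<pascal (suc u) zero    = z<s
0<pascal (suc u) (suc v) = <-≤-trans (0<pascal u (suc v)) (m≤m+n _ _)

m*n<pascal : ∀ m n → m * n < pascal m n
m*n<pascal zero    n       = z<s
m*n<pascal (suc m) zero    = s≤s (≤-reflexive (*-zeroʳ m))
m*n<pascal (suc m) (suc n) = begin-strict
  suc m * suc n                           <⟨ ≤″⇒≤ (m * n , split m n) ⟩
  suc (m * suc n) + suc (suc m * n)       ≤⟨ +-mono-≤ (m*n<pascal m (suc n)) (m*n<pascal (suc m) n) ⟩
  pascal m (suc n) + pascal (suc m) n     ∎
  where
  open ≤-Reasoning
  split : ∀ m n → suc (suc m * suc n) + m * n ≡ suc (m * suc n) + suc (suc m * n)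
  split = solve-∀

pascal-monoˡ-suc : ∀ u v → pascal u v ≤ pascal (suc u) v
pascal-monoˡ-suc zero    zero    = ≤-refl
pascal-monoˡ-suc zero    (suc v) = 0<pascal 1 (suc v)
pascal-monoˡ-suc (suc u) zero    = ≤-refl
pascal-monoˡ-suc (suc u) (suc v) = m≤m+n _ _

pascal-mono-≤ : ∀ {u u′ v v′} → u ≤ u′ → v ≤ v′ → pascal u v ≤ pascal u′ v′
pascal-mono-≤ {u} {u′} {v} {v′} u≤u′ v≤v′ =
  subst₂ (λ i j → pascal u v ≤ pascal i j) (m∸n+n≡m u≤u′) (m∸n+n≡m v≤v′) (shift (u′ ∸ u) (v′ ∸ v))
  where
  shift : ∀ k l → pascal u v ≤ pascal (k + u) (l + v)
  shift zero    zero    = ≤-refl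
  shift (suc k) l       = ≤-trans (shift k l) (pascal-monoˡ-suc (k + u) (l + v))
  shift zero    (suc l) = begin
    pascal u v              ≤⟨ shift zero l ⟩
    pascal u (l + v)        ≡⟨ pascal-comm u (l + v) ⟩
    pascal (l + v) u        ≤⟨ pascal-monoˡ-suc (l + v) u ⟩
    pascal (suc l + v) u    ≡⟨ pascal-comm (suc l + v) u ⟩
    pascal u (suc l + v)    ∎
    where open ≤-Reasoning

pascal-supermultiplicative : ∀ u₁ v₁ u₂ v₂ → pascal u₁ v₁ * pascal u₂ v₂ ≤ pascal (u₁ + u₂) (v₁ + v₂)
pascal-supermultiplicative u₁ v₁ zero v₂ = begin
  pascal u₁ v₁ * 1                ≡⟨ *-identityʳ _ ⟩
  pascal u₁ v₁                    ≤⟨ pascal-mono-≤ (m≤m+n u₁ 0) (m≤m+n v₁ v₂) ⟩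
  pascal (u₁ + 0) (v₁ + v₂)       ∎
  where open ≤-Reasoning
pascal-supermultiplicative u₁ v₁ (suc u₂) zero = begin
  pascal u₁ v₁ * 1                ≡⟨ *-identityʳ _ ⟩
  pascal u₁ v₁                    ≤⟨ pascal-mono-≤ (m≤m+n u₁ (suc u₂)) (m≤m+n v₁ 0) ⟩
  pascal (u₁ + suc u₂) (v₁ + 0)   ∎
  where open ≤-Reasoning
pascal-supermultiplicative u₁ v₁ (suc u₂) (suc v₂) rewrite +-suc u₁ u₂ | +-suc v₁ v₂ = begin
  P * (pascal u₂ (suc v₂) + pascal (suc u₂) v₂)
    ≡⟨ *-distribˡ-+ P (pascal u₂ (suc v₂)) _ ⟩
  P * pascal u₂ (suc v₂) + P * pascal (suc u₂) v₂
    ≤⟨ +-mono-≤ (pascal-supermultiplicative u₁ v₁ u₂ (suc v₂)) (pascal-supermultiplicative u₁ v₁ (suc u₂) v₂) ⟩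
  pascal (u₁ + u₂) (v₁ + suc v₂) + pascal (u₁ + suc u₂) (v₁ + v₂)
    ≡⟨ cong₂ _+_ (cong (pascal (u₁ + u₂)) (+-suc v₁ v₂)) (cong (λ w → pascal w (v₁ + v₂)) (+-suc u₁ u₂)) ⟩
  pascal (u₁ + u₂) (suc (v₁ + v₂)) + pascal (suc (u₁ + u₂)) (v₁ + v₂) ∎
  where
  open ≤-Reasoning
  P : ℕ
  P = pascal u₁ v₁

pascal-growth : ∀ u v k → (suc v + k + u * k) * pascal u (suc v) ≤ (suc v + k) * pascal u (suc v + k)
pascal-growth u v zero rewrite *-zeroʳ u | +-identityʳ v | +-identityʳ v = ≤-refl
pascal-growth u v (suc k) rewrite +-suc v k = *-cancelˡ-≤ w (begin
  w * ((suc w + u * suc k) * P)                               ≤⟨ m≤m+n _ _ ⟩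
  w * ((suc w + u * suc k) * P) + (u * u * k + u * k) * P     ≡⟨ expand u w k P ⟩
  suc (u + w) * ((w + u * k) * P)                             ≤⟨ *-monoʳ-≤ (suc (u + w)) (pascal-growth u v k) ⟩
  suc (u + w) * (w * pascal u w)                              ≡⟨ x∙yz≈y∙xz (suc (u + w)) w _ ⟩
  w * (suc (u + w) * pascal u w)                              ≡⟨ cong (w *_) (pascal-stepʳ u w) ⟨
  w * (suc w * pascal u (suc w))                              ∎)
  where
  open ≤-Reasoning
  w P : ℕ
  w = suc v + k
  P = pascal u (suc v)
  expand : ∀ u w k P → w * ((suc w + u * suc k) * P) + (u * u * k + u * k) * P
         ≡ suc (u + w) * ((w + u * k) * P)
  expand = solve-∀

[m+n]*o≡n*o+m*o : ∀ m n o → (m + n) * o ≡ n * o + m * o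
[m+n]*o≡n*o+m*o m n o = trans (*-distribʳ-+ o m n) (+-comm (m * o) (n * o))

m+1≤m*n : ∀ {m n} → 0 < m → 2 ≤ n → m + 1 ≤ m * n
m+1≤m*n {suc m} {suc (suc n)} (s≤s z≤n) (s≤s (s≤s z≤n)) = ≤″⇒≤ (m + n * suc m , poly m n)
  where
  poly : ∀ m n → suc m + 1 + (m + n * suc m) ≡ suc m * suc (suc n)
  poly = solve-∀

record RatioExceeds (a b x y K : ℕ) : Set where
  constructor ratioExceeds
  field exceeds : b * K * pascal (a * x) (a * y) < a * pascal (b * x) (b * y)

ratioExceeds-antitone : ∀ {a b x y K L} → K ≤ L → RatioExceeds a b x y L → RatioExceeds a b x y K
ratioExceeds-antitone {a} {b} {x} {y} K≤L (ratioExceeds lt) =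
  ratioExceeds (≤-<-trans (*-monoˡ-≤ (pascal (a * x) (a * y)) (*-monoʳ-≤ b K≤L)) lt)

ratioExceeds-via-pascal : ∀ {a d x y K} → (d + a) * K < a * pascal (d * x) (d * y) → RatioExceeds a (d + a) x y K
ratioExceeds-via-pascal {a} {d} {x} {y} {K} lt = ratioExceeds $ begin-strict
  (d + a) * K * B            <⟨ *-monoˡ-< B {{>-nonZero (0<pascal (a * x) (a * y))}} lt ⟩
  a * C * B                  ≡⟨ *-assoc a C B ⟩
  a * (C * B)                ≡⟨ cong (a *_) (*-comm C B) ⟩
  a * (B * C)                ≤⟨ *-monoʳ-≤ a (pascal-supermultiplicative (a * x) (a * y) (d * x) (d * y)) ⟩
  a * pascal (a * x + d * x) (a * y + d * y)  ≡⟨ cong₂ (λ u v → a * pascal u v) ([m+n]*o≡n*o+m*o d a x) ([m+n]*o≡n*o+m*o d a y) ⟨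
  a * pascal ((d + a) * x) ((d + a) * y)      ∎
  where
  open ≤-Reasoning
  B C : ℕ
  B = pascal (a * x) (a * y)
  C = pascal (d * x) (d * y)

ratioExceeds-succ-via-pascal : ∀ {a x y K} → suc a * K < a * pascal x y → RatioExceeds a (suc a) x y K
ratioExceeds-succ-via-pascal {a} {x} {y} {K} lt = ratioExceeds-via-pascal {a} {1} {x} {y} {K}
  (subst₂ (λ u v → suc a * K < a * pascal u v) (sym (*-identityˡ x)) (sym (*-identityˡ y)) lt)

ratioExceeds-diff≥2 : ∀ {a e x y} → 2 + e + a < 2 * a → 0 < x → 0 < y →
  RatioExceeds a (2 + e + a) x y ((x + 1) * y)
ratioExceeds-diff≥2 {suc a′} {e} {suc x′} {suc y′} b<2a _ _ =
  ratioExceeds-via-pascal {a} {2 + e} {x} {y} {K} (begin-strict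
    (2 + e + a) * K            <⟨ *-monoˡ-< K b<2a ⟩
    2 * a * K                  ≡⟨ *-assoc 2 a K ⟩
    2 * (a * K)                ≡⟨ x∙yz≈y∙xz 2 a K ⟩
    a * (2 * K)                ≤⟨ *-monoʳ-≤ a (≤″⇒≤ (2 * x′ * y , double x′ y′)) ⟩
    a * (2 * x * (2 * y))      <⟨ *-monoʳ-< a (m*n<pascal (2 * x) (2 * y)) ⟩
    a * pascal (2 * x) (2 * y) ≤⟨ *-monoʳ-≤ a (pascal-mono-≤ (*-monoˡ-≤ x (m≤m+n 2 e)) (*-monoˡ-≤ y (m≤m+n 2 e))) ⟩
    a * pascal ((2 + e) * x) ((2 + e) * y) ∎)
  where
  open ≤-Reasoning
  a x y K : ℕ
  a = suc a′
  x = suc x′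
  y = suc y′
  K = (x + 1) * y
  double : ∀ x′ y′ → 2 * ((suc x′ + 1) * suc y′) + 2 * x′ * suc y′ ≡ 2 * suc x′ * (2 * suc y′)
  double = solve-∀

ratioExceeds-succ-y2 : ∀ {a x} → 0 < a → RatioExceeds a (suc a) x 2 x
ratioExceeds-succ-y2 {suc i} {x} _ = ratioExceeds-succ-via-pascal {a} {x} {2} {x} (begin-strict
  suc a * x          <⟨ ≤″⇒≤ (i * x + i , poly i x) ⟩
  a * suc (x * 2)    ≤⟨ *-monoʳ-≤ a (m*n<pascal x 2) ⟩
  a * pascal x 2     ∎)
  where
  open ≤-Reasoning
  a : ℕ
  a = suc i
  poly : ∀ i x → suc (suc (suc i) * x) + (i * x + i) ≡ suc i * suc (x * 2)
  poly = solve-∀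

ratioExceeds-2-3 : ∀ {x y} → 0 < x → 3 ≤ y → RatioExceeds 2 3 x y (x + 1)
ratioExceeds-2-3 {suc j} {suc (suc (suc k))} (s≤s z≤n) (s≤s (s≤s (s≤s z≤n))) =
  ratioExceeds-succ-via-pascal {2} {x} {y} {x + 1} (begin-strict
  3 * (x + 1)        <⟨ ≤″⇒≤ (1 + 3 * j + 2 * k + 2 * j * k , poly j k) ⟩
  2 * suc (x * y)    ≤⟨ *-monoʳ-≤ 2 (m*n<pascal x y) ⟩
  2 * pascal x y     ∎)
  where
  open ≤-Reasoning
  x y : ℕ
  x = suc j
  y = 3 + k
  poly : ∀ j k → suc (3 * (suc j + 1)) + (1 + 3 * j + 2 * k + 2 * j * k) ≡ 2 * suc (suc j * (3 + k))
  poly = solve-∀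

-- Here A = (y + 1) C(a, (a + 1) y) exactly, and pascal-growth gives (2a + 1) B ≤ (a + 1) C(a, (a + 1) y).
ratioExceeds-succ-x1 : ∀ {a y} → 2 ≤ a → 0 < y → RatioExceeds a (suc a) 1 y y
ratioExceeds-succ-x1 {suc (suc i)} {suc l} (s≤s (s≤s z≤n)) (s≤s z≤n) = ratioExceeds $
  subst₂ (λ u w → suc a * y * pascal u (a * y) < a * pascal w V) (sym (*-identityʳ a)) (sym (*-identityʳ (suc a)))
    (*-cancelˡ-< (suc a) _ _ (begin-strict
      suc a * (suc a * y * B)             ≡⟨ regroup₁ a y B ⟩
      suc a * suc a * y * B               <⟨ *-monoˡ-< B {{>-nonZero (0<pascal a (a * y))}}
                                               (≤″⇒≤ (y * (1 + 3 * i + i * i) + 9 + 9 * i + 2 * i * i , poly i y)) ⟩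
      a * suc y * (2 * a + 1) * B         ≡⟨ *-assoc (a * suc y) (2 * a + 1) B ⟩
      a * suc y * ((2 * a + 1) * B)       ≤⟨ *-monoʳ-≤ (a * suc y) growth ⟩
      a * suc y * (suc a * P)             ≡⟨ regroup₂ a y P ⟩
      suc a * (a * (suc y * P))           ≡⟨ cong (λ z → suc a * (a * z)) A≡suc[y]*P ⟨
      suc a * (a * pascal (suc a) V)      ∎))
  where
  open ≤-Reasoning
  a y B V P : ℕ
  a = suc (suc i)
  y = suc l
  B = pascal a (a * y)
  V = suc a * y
  P = pascal a V
  A≡suc[y]*P : pascal (suc a) V ≡ suc y * P
  A≡suc[y]*P = *-cancelˡ-≡ _ _ (suc a) (begin-equality
    suc a * pascal (suc a) V   ≡⟨ pascal-stepˡ a V ⟩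
    suc (a + V) * P            ≡⟨ cong (_* P) (factor a y) ⟩
    suc a * suc y * P          ≡⟨ *-assoc (suc a) (suc y) P ⟩
    suc a * (suc y * P)        ∎)
    where
    factor : ∀ a y → suc (a + suc a * y) ≡ suc a * suc y
    factor = solve-∀
  growth : (2 * a + 1) * B ≤ suc a * P
  growth = *-cancelˡ-≤ y (subst₂ _≤_ (spread₁ a y B) (spread₂ a y P)
    (subst (λ v → (a * y + y + a * y) * B ≤ (a * y + y) * pascal a v) (+-comm (a * y) y)
      (pascal-growth a (l + suc i * suc l) y)))
    where
    spread₁ : ∀ a y B → (a * y + y + a * y) * B ≡ y * ((2 * a + 1) * B)
    spread₁ = solve-∀
    spread₂ : ∀ a y P → (a * y + y) * P ≡ y * (suc a * P)
    spread₂ = solve-∀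
  poly : ∀ i y → suc (suc (2 + i) * suc (2 + i) * y) + (y * (1 + 3 * i + i * i) + 9 + 9 * i + 2 * i * i)
       ≡ (2 + i) * suc y * (2 * (2 + i) + 1)
  poly = solve-∀
  regroup₁ : ∀ a y B → suc a * (suc a * y * B) ≡ suc a * suc a * y * B
  regroup₁ = solve-∀
  regroup₂ : ∀ a y P → a * suc y * (suc a * P) ≡ suc a * (a * (suc y * P))
  regroup₂ = solve-∀

ratioExceeds-succ : ∀ {a x y} → 3 ≤ a → 0 < x → 3 ≤ y → RatioExceeds a (suc a) x y (x * y)
ratioExceeds-succ {a} {1} {y} 3≤a (s≤s z≤n) (s≤s (s≤s (s≤s _))) =
  ratioExceeds-antitone (≤-reflexive (*-identityˡ y)) (ratioExceeds-succ-x1 (<⇒≤ 3≤a) (s≤s z≤n))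
ratioExceeds-succ {suc (suc (suc i))} {suc (suc j)} {suc (suc (suc k))}
                  (s≤s (s≤s (s≤s z≤n))) (s≤s z≤n) (s≤s (s≤s (s≤s z≤n))) =
  ratioExceeds-succ-via-pascal {a} {x} {y} {x * y} (begin-strict
    suc a * (x * y)                      <⟨ ≤″⇒≤ (w , poly i j k) ⟩
    a * (suc (x′ * y) + suc (x * y′))    ≤⟨ *-monoʳ-≤ a (+-mono-≤ (m*n<pascal x′ y) (m*n<pascal x y′)) ⟩
    a * pascal x y                       ∎)
  where
  open ≤-Reasoning
  a x′ x y′ y w : ℕ
  a = 3 + i
  x′ = 1 + j
  x = suc x′
  y′ = 2 + k
  y = suc y′
  w = 2 + k + 3 * j + 2 * j * k + 3 * i + i * k + 2 * i * j + i * j * k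
  poly : ∀ i j k → suc (suc (3 + i) * ((2 + j) * (3 + k))) + (2 + k + 3 * j + 2 * j * k + 3 * i + i * k + 2 * i * j + i * j * k)
       ≡ (3 + i) * (suc ((1 + j) * (3 + k)) + suc ((2 + j) * (2 + k)))
  poly = solve-∀

ratioExceeds-gap≥3 : ∀ {a b x y} → 2 ≤ a → b < 2 * a → 0 < x → 0 < y → a * y + 3 ≤ b * y → ¬ (a ≡ 2 × b ≡ 3) →
  RatioExceeds a b x y (x * y) × RatioExceeds a b x y (x + 1)
ratioExceeds-gap≥3 {a} {b} {x} {y} 2≤a b<2a 0<x 0<y gap ¬2-3
  with b ∸ a | m∸n+n≡m (*-cancelʳ-≤ a b y {{>-nonZero 0<y}} (≤-trans (m≤m+n (a * y) 3) gap))
... | d | refl =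
  by-difference d 2≤a b<2a (+-cancelˡ-≤ (a * y) 3 (d * y) (subst (a * y + 3 ≤_) ([m+n]*o≡n*o+m*o d a y) gap)) ¬2-3
  where
  instance
    y≢0 : NonZero y
    y≢0 = >-nonZero 0<y
  by-difference : ∀ {a} d → 2 ≤ a → d + a < 2 * a → 3 ≤ d * y → ¬ (a ≡ 2 × d + a ≡ 3) →
    RatioExceeds a (d + a) x y (x * y) × RatioExceeds a (d + a) x y (x + 1)
  by-difference zero _ _ () _
  by-difference {1} 1 (s≤s ()) _ _ _
  by-difference {suc (suc zero)} 1 (s≤s (s≤s z≤n)) _ _ ¬2-3 = ⊥-elim (¬2-3 (refl , refl))
  by-difference {suc (suc (suc _))} 1 (s≤s (s≤s z≤n)) _ 3≤1*y _ =
    r , ratioExceeds-antitone (m+1≤m*n 0<x (≤-trans (s≤s (s≤s z≤n)) 3≤y)) r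
    where
    3≤y : 3 ≤ y
    3≤y = subst (3 ≤_) (*-identityˡ y) 3≤1*y
    r : RatioExceeds _ _ x y (x * y)
    r = ratioExceeds-succ (s≤s (s≤s (s≤s z≤n))) 0<x 3≤y
  by-difference (suc (suc e)) _ b<2a _ _ =
    ratioExceeds-antitone (*-monoˡ-≤ y (m≤m+n x 1)) r , ratioExceeds-antitone (m≤m*n (x + 1) y) r
    where
    r : RatioExceeds _ _ x y ((x + 1) * y)
    r = ratioExceeds-diff≥2 b<2a 0<x 0<y

ratioExceeds-gap≡2 : ∀ {a b x y} → 0 < a → b < 2 * a → 0 < x → 0 < y → b * y ≡ a * y + 2 →
  RatioExceeds a b x y x × b * (x * y) * pascal (a * x) (a * y) < 2 * (a * pascal (b * x) (b * y))
ratioExceeds-gap≡2 {a} {b} {x} {y} 0<a b<2a 0<x 0<y gap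
  with b ∸ a | m∸n+n≡m (*-cancelʳ-≤ a b y {{>-nonZero 0<y}} (≤-trans (m≤m+n (a * y) 2) (≤-reflexive (sym gap))))
... | d | refl =
  by-difference d 0<y b<2a (+-cancelˡ-≡ (a * y) (d * y) 2 (trans (sym ([m+n]*o≡n*o+m*o d a y)) gap))
  where
  by-difference : ∀ d {y} → 0 < y → d + a < 2 * a → d * y ≡ 2 →
    RatioExceeds a (d + a) x y x ×
    (d + a) * (x * y) * pascal (a * x) (a * y) < 2 * (a * pascal ((d + a) * x) ((d + a) * y))
  by-difference zero _ _ ()
  by-difference 1 {1} _ _ ()
  by-difference 1 {suc (suc (suc _))} _ _ ()
  by-difference 1 {2} _ _ refl =
    r , subst (_< 2 * (a * pascal (suc a * x) (suc a * 2))) (double (suc a) x _) (*-monoʳ-< 2 (RatioExceeds.exceeds r))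
    where
    r : RatioExceeds a (suc a) x 2 x
    r = ratioExceeds-succ-y2 0<a
    double : ∀ b x B → 2 * (b * x * B) ≡ b * (x * 2) * B
    double = solve-∀
  by-difference (suc (suc e)) {y} 0<y b<2a _ =
    ratioExceeds-antitone (≤-trans (m≤m+n x 1) (m≤m*n (x + 1) y {{>-nonZero 0<y}})) r ,
    <-≤-trans (RatioExceeds.exceeds (ratioExceeds-antitone (*-monoˡ-≤ y (m≤m+n x 1)) r)) (m≤n*m _ 2)
    where
    r : RatioExceeds a _ x y ((x + 1) * y)
    r = ratioExceeds-diff≥2 b<2a 0<x 0<y

[m*n]div[m]≡n : ∀ m n .{{_ : NonZero m}} → (m * n) div m ≡ n
[m*n]div[m]≡n (suc m) n = trans (cong (_/ suc m) (*-comm (suc m) n)) (m*n/n≡m n (suc m))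

prime≢1 : ∀ {p} → Prime p → p ≢ 1
prime≢1 p-prime refl = ¬prime[1] p-prime

prime∤^* : ∀ {p q c} → Prime p → Prime q → p ≢ q → ¬ p ∣ c → ∀ k → ¬ p ∣ q ^ k * c
prime∤^* {p} {q} {c} _ _ _ p∤c zero = p∤c ∘ subst (p ∣_) (*-identityˡ c)
prime∤^* {p} {q} {c} p-prime q-prime p≢q p∤c (suc k) p∣q^[1+k]*c
  with euclidsLemma q (q ^ k * c) p-prime (subst (p ∣_) (*-assoc q (q ^ k) c) p∣q^[1+k]*c)
... | inj₂ p∣q^k*c = prime∤^* p-prime q-prime p≢q p∤c k p∣q^k*c
... | inj₁ p∣q with prime⇒irreducible q-prime p∣q
...   | inj₁ p≡1 = prime≢1 p-prime p≡1
...   | inj₂ p≡q = p≢q p≡q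

^∣^*⇒≤ : ∀ {p c} → Prime p → ¬ p ∣ c → ∀ s α → p ^ s ∣ p ^ α * c → s ≤ α
^∣^*⇒≤ _ _ zero _ _ = z≤n
^∣^*⇒≤ {p} {c} _ p∤c (suc s) zero p^[1+s]∣c =
  ⊥-elim (p∤c (∣-trans (m∣m*n (p ^ s)) (subst (p ^ suc s ∣_) (*-identityˡ c) p^[1+s]∣c)))
^∣^*⇒≤ {p} {c} p-prime p∤c (suc s) (suc α) p^[1+s]∣p^[1+α]*c =
  s≤s (^∣^*⇒≤ p-prime p∤c s α (*-cancelˡ-∣ p {{prime⇒nonZero p-prime}} (subst (p * p ^ s ∣_) (*-assoc p (p ^ α) c) p^[1+s]∣p^[1+α]*c)))

coprime*⇒∤ : ∀ {p q c} → Prime p → Coprime c (p * q) → ¬ p ∣ c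
coprime*⇒∤ {p} {q} p-prime c⊥pq p∣c = prime≢1 p-prime (c⊥pq (p∣c , m∣m*n q))

^-split : ∀ r {s α} → s ≤ α → r ^ α ≡ r ^ s * r ^ (α ∸ s)
^-split r {s} {α} s≤α = trans (cong (r ^_) (sym (m+[n∸m]≡n s≤α))) (^-distribˡ-+-* r s (α ∸ s))

∤⇒0< : ∀ {p c} → ¬ p ∣ c → 0 < c
∤⇒0< {p} {zero}  p∤0 = ⊥-elim (p∤0 (p ∣0))
∤⇒0< {p} {suc c} _   = z<s

2≤prime : ∀ {p} → Prime p → 2 ≤ p
2≤prime {p} p-prime = nonTrivial⇒n>1 p {{prime⇒nonTrivial p-prime}}

2≤prime^ : ∀ {p s} → Prime p → 0 < s → 2 ≤ p ^ s
2≤prime^ {p} {s} p-prime 0<s = begin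
  2      ≤⟨ 2≤prime p-prime ⟩
  p      ≡⟨ *-identityʳ p ⟨
  p ^ 1  ≤⟨ ^-monoʳ-≤ p {{prime⇒nonZero p-prime}} 0<s ⟩
  p ^ s  ∎
  where open ≤-Reasoning

fromℚᵘ-homo-* : ∀ u v → ℚ.fromℚᵘ (u ℚᵘ.* v) ≡ ℚ.fromℚᵘ u *ℚ ℚ.fromℚᵘ v
fromℚᵘ-homo-* u v = ℚ.toℚᵘ-injective (ℚᵘ.≃-trans (ℚ.toℚᵘ-fromℚᵘ (u ℚᵘ.* v))
  (ℚᵘ.≃-trans (ℚᵘ.*-cong (ℚᵘ.≃-sym (ℚ.toℚᵘ-fromℚᵘ u)) (ℚᵘ.≃-sym (ℚ.toℚᵘ-fromℚᵘ v)))
              (ℚᵘ.≃-sym (ℚ.toℚᵘ-homo-* (ℚ.fromℚᵘ u) (ℚ.fromℚᵘ v)))))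

fromℚᵘ-mono-< : ∀ {u v} → u ℚᵘ.< v → ℚ.fromℚᵘ u <ℚ ℚ.fromℚᵘ v
fromℚᵘ-mono-< {u} {v} u<v = ℚ.toℚᵘ-cancel-<
  (ℚᵘ.<-respˡ-≃ (ℚᵘ.≃-sym (ℚ.toℚᵘ-fromℚᵘ u)) (ℚᵘ.<-respʳ-≃ (ℚᵘ.≃-sym (ℚ.toℚᵘ-fromℚᵘ v)) u<v))

÷ℕ-*-÷ℕ : ∀ u v c d → (u ÷ℕ c) *ℚ (v ÷ℕ d) ≡ (u * v) ÷ℕ (c * d)
÷ℕ-*-÷ℕ u v zero    d       = ℚ.*-zeroˡ (v ÷ℕ d)
÷ℕ-*-÷ℕ u v (suc c) zero    = trans (ℚ.*-zeroʳ (u ÷ℕ suc c)) (cong ((u * v) ÷ℕ_) (sym (*-zeroʳ c)))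
÷ℕ-*-÷ℕ u v (suc c) (suc d) = trans (sym (fromℚᵘ-homo-* (ℚᵘ.mkℚᵘ (+ u) c) (ℚᵘ.mkℚᵘ (+ v) d)))
  (cong (λ i → ℚ.fromℚᵘ (ℚᵘ.mkℚᵘ i (d + c * suc d))) (sym (ℤ.pos-* u v)))

÷ℕ-<-÷ℕ : ∀ {u v} c d .{{_ : NonZero c}} .{{_ : NonZero d}} → u * d < v * c → u ÷ℕ c <ℚ v ÷ℕ d
÷ℕ-<-÷ℕ {u} {v} (suc c) (suc d) ud<vc =
  fromℚᵘ-mono-< {ℚᵘ.mkℚᵘ (+ u) c} {ℚᵘ.mkℚᵘ (+ v) d}
    (ℚᵘ.*<* (subst₂ _<ℤ_ (ℤ.pos-* u (suc d)) (ℤ.pos-* v (suc c)) (Data.Integer.+<+ ud<vc)))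

m+n*k<o+p*k⇒m<o-[n-p]*k : ∀ m n o p k → m + n * k < o + p * k → + m <ℤ + o -ℤ (+ n -ℤ + p) *ℤ + k
m+n*k<o+p*k⇒m<o-[n-p]*k m n o p k lt =
  subst (+ m <ℤ_) (sym difference) (Data.Integer.+<+ (m+n≤o⇒m≤o∸n (suc m) lt))
  where
  open ≡-Reasoning
  rearrange : ∀ o n p k → o -ℤ (n -ℤ p) *ℤ k ≡ (o +ℤ p *ℤ k) -ℤ n *ℤ k
  rearrange = ℤ-Solver.solve-∀
  difference : + o -ℤ (+ n -ℤ + p) *ℤ + k ≡ + (o + p * k ∸ n * k)
  difference = begin
    + o -ℤ (+ n -ℤ + p) *ℤ + k      ≡⟨ rearrange (+ o) (+ n) (+ p) (+ k) ⟩
    (+ o +ℤ + p *ℤ + k) -ℤ + n *ℤ + k ≡⟨ cong₂ _-ℤ_ (trans (ℤ.pos-+ o (p * k)) (cong (+ o +ℤ_) (ℤ.pos-* p k))) (ℤ.pos-* n k) ⟨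
    + (o + p * k) -ℤ + (n * k)      ≡⟨ ℤ.m-n≡m⊖n (o + p * k) (n * k) ⟩
    (o + p * k) ⊖ (n * k)         ≡⟨ ℤ.⊖-≥ (≤-trans (m≤n+m (n * k) m) (<⇒≤ lt)) ⟩
    + (o + p * k ∸ n * k)           ∎

module PrimePowers {p q : ℕ} (p-prime : Prime p) (q-prime : Prime q) (p≢q : p ≢ q) where

  instance
    p≢0 : NonZero p
    p≢0 = prime⇒nonZero p-prime
    q≢0 : NonZero q
    q≢0 = prime⇒nonZero q-prime

  cofactor : (α β s t c : ℕ) → ℕ
  cofactor α β s t c = p ^ (α ∸ s) * q ^ (β ∸ t) * c

  exponents≤ : ∀ {α β s t c} → Coprime c (p * q) → p ^ s ∣ p ^ α * q ^ β * c → q ^ t ∣ p ^ α * q ^ β * c → s ≤ α × t ≤ β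
  exponents≤ {α} {β} {s} {t} {c} c⊥pq p^s∣N q^t∣N =
    ^∣^*⇒≤ p-prime (prime∤^* p-prime q-prime p≢q p∤c β) s α (subst (p ^ s ∣_) (*-assoc (p ^ α) (q ^ β) c) p^s∣N) ,
    ^∣^*⇒≤ q-prime (prime∤^* q-prime p-prime (≢-sym p≢q) q∤c α) t β (subst (q ^ t ∣_) (swap (p ^ α) (q ^ β) c) q^t∣N)
    where
    p∤c : ¬ p ∣ c
    p∤c = coprime*⇒∤ p-prime c⊥pq
    q∤c : ¬ q ∣ c
    q∤c = coprime*⇒∤ q-prime (subst (Coprime c) (*-comm p q) c⊥pq)
    swap : ∀ x y z → x * y * z ≡ y * (x * z)
    swap = solve-∀

  0<cofactor : ∀ {α β s t c} → 0 < c → 0 < cofactor α β s t c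
  0<cofactor {α} {β} {s} {t} 0<c = *-mono-≤ (*-mono-≤ (m^n>0 p (α ∸ s)) (m^n>0 q (β ∸ t))) 0<c

  quotients : ∀ {α β s t c} → s ≤ α → t ≤ β →
    (p ^ α * q ^ β * c) div (p ^ s) ≡ q ^ t * cofactor α β s t c ×
    (p ^ α * q ^ β * c) div (q ^ t) ≡ p ^ s * cofactor α β s t c
  quotients {α} {β} {s} {t} {c} s≤α t≤β =
    trans (cong (_div (p ^ s)) (trans split (regroup₁ (p ^ s) (p ^ (α ∸ s)) (q ^ t) (q ^ (β ∸ t)) c))) ([m*n]div[m]≡n (p ^ s) _ {{m^n≢0 p s}}) ,
    trans (cong (_div (q ^ t)) (trans split (regroup₂ (p ^ s) (p ^ (α ∸ s)) (q ^ t) (q ^ (β ∸ t)) c))) ([m*n]div[m]≡n (q ^ t) _ {{m^n≢0 q t}})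
    where
    split : p ^ α * q ^ β * c ≡ p ^ s * p ^ (α ∸ s) * (q ^ t * q ^ (β ∸ t)) * c
    split = cong₂ (λ u v → u * v * c) (^-split p s≤α) (^-split q t≤β)
    regroup₁ : ∀ P P′ Q Q′ c → P * P′ * (Q * Q′) * c ≡ P * (Q * (P′ * Q′ * c))
    regroup₁ = solve-∀
    regroup₂ : ∀ P P′ Q Q′ c → P * P′ * (Q * Q′) * c ≡ Q * (P * (P′ * Q′ * c))
    regroup₂ = solve-∀

  q^δ≤q^t*cofactor : ∀ {γ δ s t c} → t ≤ δ → 0 < c → q ^ δ ≤ q ^ t * cofactor γ δ s t c
  q^δ≤q^t*cofactor {γ} {δ} {s} {t} {c} t≤δ 0<c = begin
    q ^ δ                                  ≡⟨ ^-split q t≤δ ⟩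
    q ^ t * q ^ (δ ∸ t)                    ≤⟨ *-monoʳ-≤ (q ^ t) (m≤n*m _ (p ^ (γ ∸ s)) {{m^n≢0 p (γ ∸ s)}}) ⟩
    q ^ t * (p ^ (γ ∸ s) * q ^ (δ ∸ t))    ≤⟨ *-monoʳ-≤ (q ^ t) (m≤m*n _ c {{>-nonZero 0<c}}) ⟩
    q ^ t * cofactor γ δ s t c             ∎
    where open ≤-Reasoning

  Δ-numerator-*-q^δ : ∀ {α β γ δ s t m′ n′} → s ≤ α → s ≤ γ → t ≤ β → t ≤ δ →
    p ^ (α + γ ∸ 2 * s) * q ^ (β ∸ t) * m′ * n′ * q ^ δ ≡ q ^ t * (cofactor γ δ s t m′ * cofactor α β s t n′)
  Δ-numerator-*-q^δ {α} {β} {γ} {δ} {s} {t} {m′} {n′} s≤α s≤γ t≤β t≤δ = begin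
    p ^ (α + γ ∸ 2 * s) * q ^ (β ∸ t) * m′ * n′ * q ^ δ
      ≡⟨ cong₂ (λ u v → u * q ^ (β ∸ t) * m′ * n′ * v) (trans (cong (p ^_) exponent) (^-distribˡ-+-* p (α ∸ s) (γ ∸ s))) (^-split q t≤δ) ⟩
    p ^ (α ∸ s) * p ^ (γ ∸ s) * q ^ (β ∸ t) * m′ * n′ * (q ^ t * q ^ (δ ∸ t))
      ≡⟨ regroup (p ^ (α ∸ s)) (p ^ (γ ∸ s)) (q ^ (β ∸ t)) (q ^ t) (q ^ (δ ∸ t)) m′ n′ ⟩
    q ^ t * (cofactor γ δ s t m′ * cofactor α β s t n′) ∎
    where
    open ≡-Reasoning
    exponent : α + γ ∸ 2 * s ≡ (α ∸ s) + (γ ∸ s)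
    exponent = trans (cong (_∸ 2 * s) (trans (cong₂ _+_ (sym (m∸n+n≡m s≤α)) (sym (m∸n+n≡m s≤γ))) (shift (α ∸ s) (γ ∸ s) s)))
                     (m+n∸n≡m _ (2 * s))
      where
      shift : ∀ a g s → (a + s) + (g + s) ≡ (a + g) + 2 * s
      shift = solve-∀
    regroup : ∀ Pα Pγ Qβ Qt Qδ m′ n′ → Pα * Pγ * Qβ * m′ * n′ * (Qt * Qδ) ≡ Qt * ((Pγ * Qδ * m′) * (Pα * Qβ * n′))
    regroup = solve-∀

Claims : (a b Q : ℕ) (D : ℚ) (nA nB A B : ℕ) → Set
Claims a b Q D nA nB A B =
  ((nB + 3 ≤ nA) → ¬ is23 → ((2 ÷ℕ 1) *ℚ D *ℚ (Q ÷ℕ 1)) <ℚ ((a * A) ÷ℕ B))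
  × ((nB + 3 ≤ nA) → ¬ is23 → 1ℚ ≤ℚ D → star₁)
  × ((nB + 3 ≤ nA) → is23 → star₁)
  × ((nA ≡ nB + 2) → ¬ is23 → (D *ℚ (Q ÷ℕ 1)) <ℚ ((a * A) ÷ℕ B))
  × ((nA ≡ nB + 2) → ¬ is23 → 1ℚ ≤ℚ D → star₂)
  where
  is23 star₁ star₂ : Set
  is23 = (a ≡ 2 × b ≡ 3) ⊎ (a ≡ 3 × b ≡ 2)
  star₁ = (+ (a * A) -ℤ (+ Q -ℤ + b) *ℤ + B) Data.Integer.> + (2 * b * B)
  star₂ = (+ (a * A) -ℤ (+ Q -ℤ + b) *ℤ + B) Data.Integer.> + (b * B)

-- P is the prime p and X / P is Δ.
module _ {a b x y P Q X : ℕ} (2≤a : 2 ≤ a) (b<2a : b < 2 * a) (0<x : 0 < x) (0<y : 0 < y) (2≤P : 2 ≤ P)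
         (XQ≡bxy : X * Q ≡ b * (x * y)) (Q≤bx : Q ≤ b * x) where

  private
    A B : ℕ
    A = pascal (b * x) (b * y)
    B = pascal (a * x) (a * y)

    instance
      B≢0 : NonZero B
      B≢0 = >-nonZero (0<pascal (a * x) (a * y))
      P≢0 : NonZero P
      P≢0 = >-nonZero (≤-trans (s≤s z≤n) 2≤P)

    open ≤-Reasoning
    open RatioExceeds

    2*aA≤aA*P : 2 * (a * A) ≤ a * A * P
    2*aA≤aA*P = ≤-trans (*-monoˡ-≤ (a * A) 2≤P) (≤-reflexive (*-comm P (a * A)))

    bound₁ : RatioExceeds a b x y (x * y) → (2 ÷ℕ 1) *ℚ (X ÷ℕ P) *ℚ (Q ÷ℕ 1) <ℚ (a * A) ÷ℕ B
    bound₁ r = subst (_<ℚ (a * A) ÷ℕ B) (sym fraction) (÷ℕ-<-÷ℕ P B (begin-strict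
      2 * (X * Q) * B          ≡⟨ cong (λ z → 2 * z * B) XQ≡bxy ⟩
      2 * (b * (x * y)) * B    ≡⟨ *-assoc 2 (b * (x * y)) B ⟩
      2 * (b * (x * y) * B)    <⟨ *-monoʳ-< 2 (exceeds r) ⟩
      2 * (a * A)              ≤⟨ 2*aA≤aA*P ⟩
      a * A * P                ∎))
      where
      fraction : (2 ÷ℕ 1) *ℚ (X ÷ℕ P) *ℚ (Q ÷ℕ 1) ≡ (2 * (X * Q)) ÷ℕ P
      fraction = trans (cong (_*ℚ (Q ÷ℕ 1)) (trans (÷ℕ-*-÷ℕ 2 X 1 P) (cong ((2 * X) ÷ℕ_) (*-identityˡ P))))
                       (trans (÷ℕ-*-÷ℕ (2 * X) Q P 1) (cong₂ _÷ℕ_ (*-assoc 2 X Q) (*-identityʳ P)))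

    bound₂ : b * (x * y) * B < 2 * (a * A) → (X ÷ℕ P) *ℚ (Q ÷ℕ 1) <ℚ (a * A) ÷ℕ B
    bound₂ lt = subst (_<ℚ (a * A) ÷ℕ B) (sym fraction) (÷ℕ-<-÷ℕ P B (begin-strict
      X * Q * B                ≡⟨ cong (_* B) XQ≡bxy ⟩
      b * (x * y) * B          <⟨ lt ⟩
      2 * (a * A)              ≤⟨ 2*aA≤aA*P ⟩
      a * A * P                ∎))
      where
      fraction : (X ÷ℕ P) *ℚ (Q ÷ℕ 1) ≡ (X * Q) ÷ℕ P
      fraction = trans (÷ℕ-*-÷ℕ X Q P 1) (cong ((X * Q) ÷ℕ_) (*-identityʳ P))

    star : ∀ K → K + Q * B < a * A + b * B → (+ (a * A) -ℤ (+ Q -ℤ + b) *ℤ + B) Data.Integer.> + K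
    star K = m+n*k<o+p*k⇒m<o-[n-p]*k K Q (a * A) b B

    star₁ : RatioExceeds a b x y (x + 1) → (+ (a * A) -ℤ (+ Q -ℤ + b) *ℤ + B) Data.Integer.> + (2 * b * B)
    star₁ r = star (2 * b * B) (begin-strict
      2 * b * B + Q * B          ≤⟨ +-monoʳ-≤ (2 * b * B) (*-monoˡ-≤ B Q≤bx) ⟩
      2 * b * B + b * x * B      ≡⟨ regroup b x B ⟩
      b * (x + 1) * B + b * B    <⟨ +-monoˡ-< (b * B) (exceeds r) ⟩
      a * A + b * B              ∎)
      where
      regroup : ∀ b x B → 2 * b * B + b * x * B ≡ b * (x + 1) * B + b * B
      regroup = solve-∀

    star₂ : RatioExceeds a b x y x → (+ (a * A) -ℤ (+ Q -ℤ + b) *ℤ + B) Data.Integer.> + (b * B)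
    star₂ r = star (b * B) (begin-strict
      b * B + Q * B            ≤⟨ +-monoʳ-≤ (b * B) (*-monoˡ-≤ B Q≤bx) ⟩
      b * B + b * x * B        <⟨ +-monoʳ-< (b * B) (exceeds r) ⟩
      b * B + a * A            ≡⟨ +-comm (b * B) (a * A) ⟩
      a * A + b * B            ∎)

    gap≥3 : a * y + 3 ≤ b * y → ¬ ((a ≡ 2 × b ≡ 3) ⊎ (a ≡ 3 × b ≡ 2)) →
      RatioExceeds a b x y (x * y) × RatioExceeds a b x y (x + 1)
    gap≥3 gap ¬2-3 = ratioExceeds-gap≥3 2≤a b<2a 0<x 0<y gap (¬2-3 ∘ inj₁)

    gap≡2 : b * y ≡ a * y + 2 → RatioExceeds a b x y x × b * (x * y) * B < 2 * (a * A)
    gap≡2 = ratioExceeds-gap≡2 (≤-trans (s≤s z≤n) 2≤a) b<2a 0<x 0<y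

    gap≥3-2-3 : a * y + 3 ≤ b * y → (a ≡ 2 × b ≡ 3) ⊎ (a ≡ 3 × b ≡ 2) → RatioExceeds a b x y (x + 1)
    gap≥3-2-3 gap (inj₁ (refl , refl)) =
      ratioExceeds-2-3 0<x (+-cancelˡ-≤ (2 * y) 3 y (subst (2 * y + 3 ≤_) (triple y) gap))
      where
      triple : ∀ y → 3 * y ≡ 2 * y + y
      triple = solve-∀
    gap≥3-2-3 gap (inj₂ (refl , refl)) =
      ⊥-elim (<⇒≱ (*-cancelʳ-< y 3 2 (<-≤-trans (m<m+n (3 * y) z<s) gap)) (s≤s (s≤s z≤n)))

  claims : ∀ {mA nA mB nB} → mA ≡ b * x → nA ≡ b * y → mB ≡ a * x → nB ≡ a * y →
    Claims a b Q (X ÷ℕ P) nA nB (multinom mA nA) (multinom mB nB)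
  claims refl refl refl refl rewrite multinom≡pascal (b * x) (b * y) | multinom≡pascal (a * x) (a * y) =
    (λ gap ¬2-3 → bound₁ (proj₁ (gap≥3 gap ¬2-3))) ,
    (λ gap ¬2-3 _ → star₁ (proj₂ (gap≥3 gap ¬2-3))) ,
    (λ gap 2-3 → star₁ (gap≥3-2-3 gap 2-3)) ,
    (λ gap _ → bound₂ (proj₂ (gap≡2 gap))) ,
    (λ gap _ _ → star₂ (proj₁ (gap≡2 gap)))

lemma2p2 : (p q α β γ δ s t n' m' : ℕ) →
    Prime p → Prime q → p ≢ q →
    1 ≤ α → 1 ≤ β → 1 ≤ γ → 1 ≤ δ →
    Coprime n' (p * q) → Coprime m' (p * q) →
    1 ≤ s → 1 ≤ t →
    q ^ t < 2 * p ^ s →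
    p ^ s ∣ gcd (p ^ γ * q ^ δ * m') (p ^ α * q ^ β * n') →
    q ^ t ∣ gcd (p ^ γ * q ^ δ * m') (p ^ α * q ^ β * n') →
    let n = p ^ α * q ^ β * n'
        m = p ^ γ * q ^ δ * m'
        a = p ^ s
        b = q ^ t
        A = multinom (m div a) (n div a)
        B = multinom (m div b) (n div b)
        D = Δ p q α β γ s t m' n'
        is23 = (a ≡ 2 × b ≡ 3) ⊎ (a ≡ 3 × b ≡ 2)
        star1 = (+ (a * A) -ℤ (+ (q ^ δ) -ℤ + (q ^ t)) *ℤ + B) Data.Integer.> + (2 * b * B)
        star2 = (+ (a * A) -ℤ (+ (q ^ δ) -ℤ + (q ^ t)) *ℤ + B) Data.Integer.> + (b * B)
    in
    ((n div b + 3 ≤ n div a) → ¬ is23 →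
       ((2 ÷ℕ 1) *ℚ D *ℚ ((q ^ δ) ÷ℕ 1)) <ℚ ((a * A) ÷ℕ B))
    ×
    ((n div b + 3 ≤ n div a) → ¬ is23 → 1ℚ ≤ℚ D → star1)
    ×
    ((n div b + 3 ≤ n div a) → is23 → star1)
    ×
    ((n div a ≡ n div b + 2) → ¬ is23 →
       (D *ℚ ((q ^ δ) ÷ℕ 1)) <ℚ ((a * A) ÷ℕ B))
    ×
    ((n div a ≡ n div b + 2) → ¬ is23 → 1ℚ ≤ℚ D → star2)
lemma2p2 p q α β γ δ s t n' m' p-prime q-prime p≢q _ _ _ _ n'⊥pq m'⊥pq 0<s _ b<2a p^s∣gcd q^t∣gcd =
  claims {x = cofactor γ δ s t m'} {y = cofactor α β s t n'}
    (2≤prime^ p-prime 0<s) b<2a (0<cofactor {γ} {δ} {s} {t} 0<m') (0<cofactor {α} {β} {s} {t} 0<n') (2≤prime p-prime)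
    (Δ-numerator-*-q^δ {m′ = m'} {n′ = n'} s≤α s≤γ t≤β t≤δ) (q^δ≤q^t*cofactor {γ} {s = s} t≤δ 0<m')
    (proj₁ m-quotients) (proj₁ n-quotients) (proj₂ m-quotients) (proj₂ n-quotients)
  where
  open PrimePowers p-prime q-prime p≢q
  m n : ℕ
  m = p ^ γ * q ^ δ * m'
  n = p ^ α * q ^ β * n'
  0<m' : 0 < m'
  0<m' = ∤⇒0< (coprime*⇒∤ p-prime m'⊥pq)
  0<n' : 0 < n'
  0<n' = ∤⇒0< (coprime*⇒∤ p-prime n'⊥pq)
  m-exponents : s ≤ γ × t ≤ δ
  m-exponents = exponents≤ m'⊥pq (∣-trans p^s∣gcd (gcd[m,n]∣m m n)) (∣-trans q^t∣gcd (gcd[m,n]∣m m n))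
  n-exponents : s ≤ α × t ≤ β
  n-exponents = exponents≤ n'⊥pq (∣-trans p^s∣gcd (gcd[m,n]∣n m n)) (∣-trans q^t∣gcd (gcd[m,n]∣n m n))
  s≤γ : s ≤ γ
  s≤γ = proj₁ m-exponents
  t≤δ : t ≤ δ
  t≤δ = proj₂ m-exponents
  s≤α : s ≤ α
  s≤α = proj₁ n-exponents
  t≤β : t ≤ β
  t≤β = proj₂ n-exponents
  m-quotients : m div (p ^ s) ≡ q ^ t * cofactor γ δ s t m' × m div (q ^ t) ≡ p ^ s * cofactor γ δ s t m'
  m-quotients = quotients s≤γ t≤δ
  n-quotients : n div (p ^ s) ≡ q ^ t * cofactor α β s t n' × n div (q ^ t) ≡ p ^ s * cofactor α β s t n'
  n-quotients = quotients s≤α t≤β
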